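{- Let $\mathcal{T}$ be an extensional typed combinatory algebra for which $|\bot|$ is inhabited. Then in the internal logic of the category of assemblies $\mathbf{Asm}_{\mathcal{T}}$ the independence of premise principle \[ (\neg \phi \rightarrow \exists y^Y \, \psi(y)) \rightarrow (\exists y^Y \, (\neg \phi \rightarrow \psi(y))) \] is valid (in any context, with $y$ not free in $\phi$) for every assembly $Y$ that is both modest and exhaustive.
   Context: A typed combinatory algebra (tca) $\mathcal{T}$ consists of a set of types containing distinguished types $\bot,\top,N$ and closed under binary operations $\times,\to,+$; for each type $T$ a set $|T|$; and total application maps $|S\to T|\times|S|\to|T|$, $(a,b)\mapsto ab$, such that for all types $S,T,U$ there are elements $\mathsf{exf}\in|\bot\to S|$, $\mathsf{t}\in|\top|$, $\mathsf{k}\in|S\to T\to S|$, $\mathsf{s}\in|(S\to T\to U)\to(S\to T)\to(S\to U)|$, $\mathsf{pair}\in|S\to T\to S\times T|$, $\mathsf{fst},\mathsf{snd}$, $\mathsf{inl}\in|S\to S+T|$, $\mathsf{inr}\in|T\to S+T|$, $\mathsf{case}\in|(S\to U)\to(T\to U)\to(S+T\to U)|$, $\mathsf{0}\in|N|$, $\mathsf{succ}\in|N\to N|$, $\mathsf{R}\in|S\to(N\to(S\to S))\to(N\to S)|$ with $\mathsf{k}ab=a$, $\mathsf{s}abc=ac(bc)$, $\mathsf{fst}(\mathsf{pair}ab)=a$, $\mathsf{snd}(\mathsf{pair}ab)=b$, $\mathsf{case}ab(\mathsf{inl}x)=ax$, $\mathsf{case}ab(\mathsf{inr}x)=bx$,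 $\mathsf{R}ab\mathsf{0}=a$, $\mathsf{R}ab(\mathsf{succ}n)=bn(\mathsf{R}abn)$. $\mathcal{T}$ is extensional if for all types $S,T$ the maps $|S\times T|\to|S|\times|T|$, $x\mapsto(\mathsf{fst}x,\mathsf{snd}x)$ and $|T\to S|\to|S|^{|T|}$, $x\mapsto(y\mapsto xy)$ are injective, and $\mathsf t$ is the only element of $|\top|$. An assembly over $\mathcal{T}$ is a triple $(X,A,\alpha)$ with $X$ a set, $A$ a type, and $\alpha$ assigning to each $x\in X$ an inhabited subset $\alpha(x)\subseteq|A|$; a morphism $(X,A,\alpha)\to(Y,B,\beta)$ is a function $f:X\to Y$ such that some $e\in|A\to B|$ satisfies $a\in\alpha(x)\Rightarrow ea\in\beta(f(x))$. These form the category $\mathbf{Asm}_{\mathcal{T}}$, a Heyting category whose internal logic is meant. An assembly $(X,A,\alpha)$ is modest if $a\in\alpha(x)$, $a\in\alpha(y)$ imply $x=y$, and exhaustive if every $a\in|A|$ lies in $\alpha(x)$ for some $x\in X$. -}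

module Defs where

open import Data.Empty using (⊥)
open import Data.Product using (Σ; _×_; _,_; proj₁; proj₂)
open import Relation.Binary.PropositionalEquality using (_≡_)

record TCA : Set₁ where
  infixr 5 _⇒_
  infixr 7 _×ᵗ_
  infixr 6 _+ᵗ_
  field
    Ty   : Set
    ⊥ᵗ ⊤ᵗ Nᵗ : Ty
    _×ᵗ_ _⇒_ _+ᵗ_ : Ty → Ty → Ty
    El   : Ty → Set
    app  : ∀ {S T} → El (S ⇒ T) → El S → El T

    exf  : ∀ {S} → El (⊥ᵗ ⇒ S)
    t    : El ⊤ᵗ
    k    : ∀ {S T} → El (S ⇒ T ⇒ S)
    s    : ∀ {S T U} → El ((S ⇒ T ⇒ U) ⇒ (S ⇒ T) ⇒ (S ⇒ U))
    pair : ∀ {S T} → El (S ⇒ T ⇒ (S ×ᵗ T))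
    fst  : ∀ {S T} → El ((S ×ᵗ T) ⇒ S)
    snd  : ∀ {S T} → El ((S ×ᵗ T) ⇒ T)
    inl  : ∀ {S T} → El (S ⇒ (S +ᵗ T))
    inr  : ∀ {S T} → El (T ⇒ (S +ᵗ T))
    case : ∀ {S T U} → El ((S ⇒ U) ⇒ (T ⇒ U) ⇒ ((S +ᵗ T) ⇒ U))
    zer  : El Nᵗ
    succ : El (Nᵗ ⇒ Nᵗ)
    rec  : ∀ {S} → El (S ⇒ (Nᵗ ⇒ (S ⇒ S)) ⇒ (Nᵗ ⇒ S))

    k-eq    : ∀ {S T} (a : El S) (b : El T) →
              app {T} {S} (app {S} {T ⇒ S} k a) b ≡ a
    s-eq    : ∀ {S T U} (a : El (S ⇒ T ⇒ U)) (b : El (S ⇒ T)) (c : El S) →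
              app {S} {U} (app {S ⇒ T} {S ⇒ U} (app {S ⇒ T ⇒ U} {(S ⇒ T) ⇒ (S ⇒ U)} s a) b) c
                ≡ app {T} {U} (app {S} {T ⇒ U} a c) (app {S} {T} b c)
    fst-eq  : ∀ {S T} (a : El S) (b : El T) →
              app {S ×ᵗ T} {S} fst (app {T} {S ×ᵗ T} (app {S} {T ⇒ (S ×ᵗ T)} pair a) b) ≡ a
    snd-eq  : ∀ {S T} (a : El S) (b : El T) →
              app {S ×ᵗ T} {T} snd (app {T} {S ×ᵗ T} (app {S} {T ⇒ (S ×ᵗ T)} pair a) b) ≡ b
    inl-eq  : ∀ {S T U} (a : El (S ⇒ U)) (b : El (T ⇒ U)) (x : El S) →
              app {S +ᵗ T} {U} (app {T ⇒ U} {(S +ᵗ T) ⇒ U} (app {S ⇒ U} {(T ⇒ U) ⇒ ((S +ᵗ T) ⇒ U)} case a) b)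
                  (app {S} {S +ᵗ T} inl x) ≡ app a x
    inr-eq  : ∀ {S T U} (a : El (S ⇒ U)) (b : El (T ⇒ U)) (x : El T) →
              app {S +ᵗ T} {U} (app {T ⇒ U} {(S +ᵗ T) ⇒ U} (app {S ⇒ U} {(T ⇒ U) ⇒ ((S +ᵗ T) ⇒ U)} case a) b)
                  (app {T} {S +ᵗ T} inr x) ≡ app b x
    rec-zer : ∀ {S} (a : El S) (b : El (Nᵗ ⇒ (S ⇒ S))) →
              app {Nᵗ} {S} (app {Nᵗ ⇒ (S ⇒ S)} {Nᵗ ⇒ S} (app {S} {(Nᵗ ⇒ (S ⇒ S)) ⇒ (Nᵗ ⇒ S)} rec a) b) zer ≡ a
    rec-suc : ∀ {S} (a : El S) (b : El (Nᵗ ⇒ (S ⇒ S))) (n : El Nᵗ) →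
              app {Nᵗ} {S} (app {Nᵗ ⇒ (S ⇒ S)} {Nᵗ ⇒ S} (app {S} {(Nᵗ ⇒ (S ⇒ S)) ⇒ (Nᵗ ⇒ S)} rec a) b)
                  (app succ n)
                ≡ app {S} {S} (app {Nᵗ} {S ⇒ S} b n)
                      (app {Nᵗ} {S} (app {Nᵗ ⇒ (S ⇒ S)} {Nᵗ ⇒ S} (app {S} {(Nᵗ ⇒ (S ⇒ S)) ⇒ (Nᵗ ⇒ S)} rec a) b) n)

module _ (𝒯 : TCA) where
  open TCA 𝒯

  record Extensional : Set where
    field
      pair-inj : ∀ {S T} (x y : El (S ×ᵗ T)) →
                 app {S ×ᵗ T} {S} fst x ≡ app {S ×ᵗ T} {S} fst y →
                 app {S ×ᵗ T} {T} snd x ≡ app {S ×ᵗ T} {T} snd y → x ≡ y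
      fun-inj  : ∀ {S T} (x y : El (T ⇒ S)) →
                 (∀ z → app {T} {S} x z ≡ app {T} {S} y z) → x ≡ y
      top-unique : ∀ (x : El ⊤ᵗ) → x ≡ t

  record Assembly : Set₁ where
    field
      Car  : Set
      RTy  : Ty
      real : Car → El RTy → Set          -- α(x) as a subset of |A|
      inhabited : ∀ x → Σ (El RTy) (real x)
  open Assembly public

  Modest : Assembly → Set
  Modest (record { Car = X ; RTy = A ; real = α }) =
    ∀ (x y : X) (a : El A) → α x a → α y a → x ≡ y

  Exhaustive : Assembly → Set
  Exhaustive (record { Car = X ; RTy = A ; real = α }) =
    ∀ (a : El A) → Σ X (λ x → α x a)

  record Hom (X Y : Assembly) : Set where
    field
      fun : Car X → Car Y
      tracker : Σ (El (RTy X ⇒ RTy Y)) λ e →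
                ∀ x a → real X x a → real Y (fun x) (app e a)

  -- Internal logic of Asm_𝒯: predicates (= subobjects) on an assembly Γ,
  -- represented in the standard realizability way by a type B together
  -- with a family of (possibly empty) subsets of |B| indexed by Car Γ.

  record Pred (X : Set) : Set₁ where
    field
      PTy : Ty
      holds : X → El PTy → Set
  open Pred public

  Falsum : ∀ {X} → Pred X
  Falsum = record { PTy = ⊥ᵗ ; holds = λ _ _ → ⊥ }

  Imp : ∀ {X} → Pred X → Pred X → Pred X
  Imp P Q = record
    { PTy = PTy P ⇒ PTy Q
    ; holds = λ x f → ∀ b → holds P x b → holds Q x (app {PTy P} {PTy Q} f b) }

  Neg : ∀ {X} → Pred X → Pred X
  Neg P = Imp P Falsum

  Wk : ∀ {X} (Y : Assembly) → Pred X → Pred (X × Car Y)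
  Wk Y P = record { PTy = PTy P ; holds = λ xy b → holds P (proj₁ xy) b }

  Ex : ∀ {X} (Y : Assembly) → Pred (X × Car Y) → Pred X
  Ex Y P = record
    { PTy = RTy Y ×ᵗ PTy P
    ; holds = λ x c → Σ (Car Y) λ y →
        real Y y (app {RTy Y ×ᵗ PTy P} {RTy Y} fst c)
        × holds P (x , y) (app {RTy Y ×ᵗ PTy P} {PTy P} snd c) }

  -- A predicate on Γ is valid (equals the top subobject) iff it is
  -- uniformly realized from realizers of the context.
  Valid : (Γ : Assembly) → Pred (Car Γ) → Set
  Valid Γ P = Σ (El (RTy Γ ⇒ PTy P)) λ e →
    ∀ x a → real Γ x a → holds P x (app {RTy Γ} {PTy P} e a)

  -- The independence of premise principle for φ in context Γ and ψ in
  -- context Γ × Y (so y is not free in φ):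
  --   (¬φ → ∃y ψ(y)) → ∃y (¬φ → ψ(y))
  IP-instance : (Γ Y : Assembly) → Pred (Car Γ) → Pred (Car Γ × Car Y) → Pred (Car Γ)
  IP-instance Γ Y φ ψ =
    Imp (Imp (Neg φ) (Ex Y ψ)) (Ex Y (Imp (Neg (Wk Y φ)) ψ))

  IPValidFor : Assembly → Set₁
  IPValidFor Y = ∀ (Γ : Assembly) (φ : Pred (Car Γ)) (ψ : Pred (Car Γ × Car Y)) →
    Valid Γ (IP-instance Γ Y φ ψ)

{-# OPTIONS --safe #-}
-- A realizer of a negation carries no information: ¬φ is realized by every
-- element of its type as soon as it is realized at all.  Since |⊥| is
-- inhabited, the type of ¬φ has a fixed element n₀, which may be fed to a
-- realizer f of ¬φ → ∃y ψ(y) without knowing whether ¬φ holds.  Exhaustivity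
-- turns fst (f n₀) into a realizer of some y, chosen independently of ¬φ;
-- if ¬φ does hold, f n₀ realizes ψ(y′) for a y′ also realized by fst (f n₀),
-- and modesty gives y′ = y.  Hence pair (fst (f n₀)) (k (snd (f n₀)))
-- realizes ∃y (¬φ → ψ(y)).
module Submission where

open import Defs
open import Data.Product using (_×_; _,_; proj₁; proj₂)
open import Relation.Binary.PropositionalEquality using (_≡_; sym; trans; cong; cong₂; subst)

module Combinators (𝒯 : TCA) where
  open TCA 𝒯

  I : ∀ {S} → El (S ⇒ S)
  I {S} = app (app (s {S} {S ⇒ S} {S}) k) (k {S} {S})

  I-eq : ∀ {S} (x : El S) → app I x ≡ x
  I-eq {S} x = trans (s-eq k k x) (k-eq x (app (k {S} {S}) x))

  B : ∀ {R S T} → El (S ⇒ T) → El (R ⇒ S) → El (R ⇒ T)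
  B {R} {S} {T} g h = app (app (s {R} {S} {T}) (app k g)) h

  B-eq : ∀ {R S T} (g : El (S ⇒ T)) (h : El (R ⇒ S)) (x : El R) →
         app (B g h) x ≡ app g (app h x)
  B-eq g h x = trans (s-eq (app k g) h x) (cong (λ g′ → app g′ (app h x)) (k-eq g x))

  apply-to : ∀ {S T} → El S → El ((S ⇒ T) ⇒ T)
  apply-to a = app (app s I) (app k a)

  apply-to-eq : ∀ {S T} (a : El S) (f : El (S ⇒ T)) → app (apply-to a) f ≡ app f a
  apply-to-eq a f = trans (s-eq I (app k a) f) (cong₂ app (I-eq f) (k-eq a f))

  const-snd : ∀ {S T U} → El ((S ×ᵗ T) ⇒ (S ×ᵗ (U ⇒ T)))
  const-snd = app (app s (app (app s (app k pair)) fst)) (B k snd)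

  const-snd-eq : ∀ {S T U} (c : El (S ×ᵗ T)) →
                 app (const-snd {U = U}) c ≡ app (app pair (app fst c)) (app k (app snd c))
  const-snd-eq c = trans (s-eq _ (B k snd) c)
    (cong₂ app (trans (s-eq (app k pair) fst c) (cong (λ p → app p (app fst c)) (k-eq pair c)))
               (B-eq k snd c))

  fst-const-snd : ∀ {S T U} (c : El (S ×ᵗ T)) →
                  app fst (app (const-snd {U = U}) c) ≡ app fst c
  fst-const-snd c = trans (cong (app fst) (const-snd-eq c)) (fst-eq _ _)

  snd-const-snd : ∀ {S T U} (c : El (S ×ᵗ T)) (u : El U) →
                  app (app snd (app const-snd c)) u ≡ app snd c
  snd-const-snd c u =
    trans (cong (λ g → app g u) (trans (cong (app snd) (const-snd-eq c)) (snd-eq _ _)))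
          (k-eq _ u)

module _ (𝒯 : TCA) where
  open TCA 𝒯
  open Combinators 𝒯

  valid-Imp : (Γ : Assembly 𝒯) (P Q : Pred 𝒯 (Car Γ)) (e : El (PTy P ⇒ PTy Q)) →
              (∀ x b → holds P x b → holds Q x (app e b)) → Valid 𝒯 Γ (Imp 𝒯 P Q)
  valid-Imp Γ P Q e e-realizes = app k e , λ x a _ b b-realizes →
    subst (λ e′ → holds Q x (app e′ b)) (sym (k-eq e a)) (e-realizes x b b-realizes)

  module _ (Y : Assembly 𝒯) where

    Modest⇒Ex-at-realized : Modest 𝒯 Y → ∀ {X} (P : Pred 𝒯 (X × Car Y)) {x c y} →
                            holds (Ex 𝒯 Y P) x c → real Y y (app fst c) →
                            holds P (x , y) (app snd c)
    Modest⇒Ex-at-realized mod P {x} {c} {y} (y′ , y′-real , p) y-real =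
      subst (λ z → holds P (x , z) (app snd c)) (mod y′ y _ y′-real y-real) p

    module _ {X : Set} (φ : Pred 𝒯 X) (ψ : Pred 𝒯 (X × Car Y)) where

      const-snd-realizes-IP :
        Modest 𝒯 Y → Exhaustive 𝒯 Y → ∀ {x c} →
        (∀ n → holds (Neg 𝒯 φ) x n → holds (Ex 𝒯 Y ψ) x c) →
        holds (Ex 𝒯 Y (Imp 𝒯 (Neg 𝒯 (Wk 𝒯 Y φ)) ψ)) x (app const-snd c)
      const-snd-realizes-IP mod exh {x} {c} c-realizes-under-¬φ =
        y , subst (real Y y) (sym (fst-const-snd c)) y-real , ψ-realized
        where
          y = proj₁ (exh (app fst c))
          y-real = proj₂ (exh (app fst c))
          ψ-realized : ∀ n → holds (Neg 𝒯 φ) x n →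
                       holds ψ (x , y) (app (app snd (app const-snd c)) n)
          ψ-realized n ¬φ = subst (holds ψ (x , y)) (sym (snd-const-snd c n))
            (Modest⇒Ex-at-realized mod ψ (c-realizes-under-¬φ n ¬φ) y-real)

      IP-realizer : El (PTy φ ⇒ ⊥ᵗ) → El (PTy (Imp 𝒯 (Neg 𝒯 φ) (Ex 𝒯 Y ψ)) ⇒
                                          PTy (Ex 𝒯 Y (Imp 𝒯 (Neg 𝒯 (Wk 𝒯 Y φ)) ψ)))
      IP-realizer n₀ = B const-snd (apply-to n₀)

      IP-realizer-eq : ∀ n₀ f → app (IP-realizer n₀) f ≡ app const-snd (app f n₀)
      IP-realizer-eq n₀ f =
        trans (B-eq const-snd (apply-to n₀) f) (cong (app const-snd) (apply-to-eq n₀ f))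

      IP-realizer-realizes :
        Modest 𝒯 Y → Exhaustive 𝒯 Y → (n₀ : El (PTy φ ⇒ ⊥ᵗ)) → ∀ x f →
        holds (Imp 𝒯 (Neg 𝒯 φ) (Ex 𝒯 Y ψ)) x f →
        holds (Ex 𝒯 Y (Imp 𝒯 (Neg 𝒯 (Wk 𝒯 Y φ)) ψ)) x (app (IP-realizer n₀) f)
      IP-realizer-realizes mod exh n₀ x f f-realizes =
        subst (holds (Ex 𝒯 Y (Imp 𝒯 (Neg 𝒯 (Wk 𝒯 Y φ)) ψ)) x) (sym (IP-realizer-eq n₀ f))
          -- holds (Neg φ) x n does not depend on n, so ¬φ is realized by n₀ too.
          (const-snd-realizes-IP mod exh λ _ ¬φ → f-realizes n₀ ¬φ)

mainTheorem4 : (𝒯 : TCA) → Extensional 𝒯 → TCA.El 𝒯 (TCA.⊥ᵗ 𝒯) →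
    (Y : Assembly 𝒯) → Modest 𝒯 Y → Exhaustive 𝒯 Y → IPValidFor 𝒯 Y
mainTheorem4 𝒯 _ z Y mod exh Γ φ ψ =
  valid-Imp 𝒯 Γ (Imp 𝒯 (Neg 𝒯 φ) (Ex 𝒯 Y ψ)) (Ex 𝒯 Y (Imp 𝒯 (Neg 𝒯 (Wk 𝒯 Y φ)) ψ))
    (IP-realizer 𝒯 Y φ ψ n₀)
    (IP-realizer-realizes 𝒯 Y φ ψ mod exh n₀)
  where
    open TCA 𝒯
    n₀ : El (PTy φ ⇒ ⊥ᵗ)
    n₀ = app k z
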